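{- Let $C=(S,f)$ be a classifier model, $s\in S$, $x\in\mathit{Val}$, and $\lambda$ a term. Then $\lambda$ is a prime implicant of $x$ with respect to $f$ (i.e. $(C,s)\models\mathsf{PImp}(\lambda,x)$) if and only if $$(C,s)\models[\emptyset]\Big(\lambda\rightarrow\big(\mathsf{t}(x)\wedge\bigwedge_{p\in\mathit{Atm}(\lambda)}\langle\mathit{Atm}(\lambda)\setminus\{p\}\rangle\neg\mathsf{t}(x)\big)\Big).$$
   Context: $\mathit{Atm}$ is a finite set of atomic propositions containing the decision atoms $\mathit{Dec}=\{\mathsf{t}(x):x\in\mathit{Val}\}$, $\mathit{Val}$ a finite set of decision values. Language $\mathcal{L}(\mathit{Atm})$: $\varphi::=p\mid\neg\varphi\mid\varphi\wedge\varphi\mid[X]\varphi$ ($p\in\mathit{Atm}$, $X\subseteq\mathit{Atm}$), $\langle X\rangle\varphi:=\neg[X]\neg\varphi$. A classifier model is $C=(S,f)$ with $S=2^{\mathit{Atm}\setminus\mathit{Dec}}$, $f:S\to\mathit{Val}$; at $(C,s)$: $p\in\mathit{Atm}\setminus\mathit{Dec}$ true iff $p\in s$; $\mathsf{t}(x)$ true iff $f(s)=x$; Boolean clauses as usual; $[X]\varphi$ true iff $\varphi$ true at all $s'\in S$ with $s\cap X=s'\cap X$. A term is a formula $\lambda=\bigwedge_{p\in X}p\wedge\bigwedge_{p\in Y}\neg p$ with $X,Y\subseteq\mathit{Atm}\setminus\mathit{Dec}$ disjoint ($\top$ is the empty term); $\mathit{Atm}(\lambda)=X\cup Y$; $\lambda'\subset\lambda$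 means the set of literals of $\lambda'$ is a proper subset of that of $\lambda$. $\lambda$ is an implicant of $x$ w.r.t. $f$ if for every $s'\in S$, $(C,s')\models\lambda$ implies $f(s')=x$; it is a prime implicant of $x$ if it is an implicant of $x$ and no term $\lambda'\subset\lambda$ is an implicant of $x$. -}

module Defs where

open import Data.Nat using (ℕ; suc)
open import Data.Fin using (Fin; zero; _≟_)
open import Data.Fin.Base using ()
open import Data.Bool using (Bool; true; false; _∧_; not)
import Data.Bool as B
open import Data.Maybe using (Maybe; just; nothing; is-just)
open import Data.List using (List; []; _∷_; map; filter)
open import Data.List.Base using (allFin)
open import Data.Product using (_×_)
open import Relation.Nullary using (¬_; does)
open import Relation.Unary using ()
open import Relation.Binary.PropositionalEquality using (_≡_)

-- Atoms: Atm = (Atm \ Dec) ⊎ Dec, with Atm \ Dec = Fin n and Val = Fin m,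
-- decision atoms t(x) for x ∈ Val.
data Atom (n m : ℕ) : Set where
  var : Fin n → Atom n m
  t   : Fin m → Atom n m

AtmSet : ℕ → ℕ → Set
AtmSet n m = Atom n m → Bool

∅ : ∀ {n m} → AtmSet n m
∅ _ = false

data Fm (n m : ℕ) : Set where
  atom : Atom n m → Fm n m
  ¬'_  : Fm n m → Fm n m
  _∧'_ : Fm n m → Fm n m → Fm n m
  [_]_ : AtmSet n m → Fm n m → Fm n m

infixr 6 _∧'_
infix 7 ¬'_
infixr 5 _⇒_
infix 8 [_]_ ⟨_⟩_

⟨_⟩_ : ∀ {n m} → AtmSet n m → Fm n m → Fm n m
⟨ X ⟩ φ = ¬' ([ X ] (¬' φ))

_⇒_ : ∀ {n m} → Fm n m → Fm n m → Fm n m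
φ ⇒ ψ = ¬' (φ ∧' (¬' ψ))

⊤' : ∀ {n m} → Fm n (suc m)
⊤' = ¬' (atom (t zero) ∧' (¬' atom (t zero)))

State : ℕ → Set
State n = Fin n → Bool

-- A classifier model C = (S, f) is determined by f : S → Val.
Classifier : ℕ → ℕ → Set
Classifier n m = State n → Fin m

-- s ∩ X = s' ∩ X  (only non-decision atoms can be in states)
SameOn : ∀ {n m} → AtmSet n m → State n → State n → Set
SameOn X s s' = ∀ p → X (var p) ≡ true → s p ≡ s' p

_,_⊨_ : ∀ {n m} → Classifier n m → State n → Fm n m → Set
C , s ⊨ atom (var p) = s p ≡ true
C , s ⊨ atom (t x)   = C s ≡ x
C , s ⊨ (¬' φ)       = ¬ (C , s ⊨ φ)
C , s ⊨ (φ ∧' ψ)     = (C , s ⊨ φ) × (C , s ⊨ ψ)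
C , s ⊨ ([ X ] φ)    = ∀ s' → SameOn X s s' → C , s' ⊨ φ

⋀ : ∀ {n m} → List (Fm n (suc m)) → Fm n (suc m)
⋀ []           = ⊤'
⋀ (φ ∷ [])     = φ
⋀ (φ ∷ ψ ∷ ψs) = φ ∧' ⋀ (ψ ∷ ψs)

-- Terms: each non-decision atom occurs positively (just true), negatively
-- (just false) or not at all (nothing); X, Y are automatically disjoint.
Term : ℕ → Set
Term n = Fin n → Maybe Bool

literals : ∀ {n m} → Term n → List (Fm n m)
literals {n} l = go (allFin n)
  where
  go : List (Fin n) → List (Fm _ _)
  go [] = []
  go (p ∷ ps) with l p
  ... | nothing    = go ps
  ... | just true  = atom (var p) ∷ go ps
  ... | just false = (¬' atom (var p)) ∷ go ps

termFm : ∀ {n m} → Term n → Fm n (suc m)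
termFm l = ⋀ (literals l)

AtmT : ∀ {n m} → Term n → AtmSet n m
AtmT l (var q) = is-just (l q)
AtmT l (t _)   = false

_∖_ : ∀ {n m} → AtmSet n m → Fin n → AtmSet n m
(X ∖ p) (var q) = X (var q) ∧ not (does (p ≟ q))
(X ∖ p) (t y)   = X (t y)

_⊆ₜ_ : ∀ {n} → Term n → Term n → Set
l' ⊆ₜ l = ∀ p b → l' p ≡ just b → l p ≡ just b

_⊂ₜ_ : ∀ {n} → Term n → Term n → Set
l' ⊂ₜ l = (l' ⊆ₜ l) × ¬ (∀ p → l' p ≡ l p)

Implicant : ∀ {n m} → Classifier n (suc m) → Term n → Fin (suc m) → Set
Implicant C l x = ∀ s' → C , s' ⊨ termFm l → C s' ≡ x

PrimeImplicant : ∀ {n m} → Classifier n (suc m) → Term n → Fin (suc m) → Set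
PrimeImplicant C l x = Implicant C l x × (∀ l' → l' ⊂ₜ l → ¬ Implicant C l' x)

RHS : ∀ {n m} → Term n → Fin (suc m) → Fm n (suc m)
RHS {n} l x =
  [ ∅ ] (termFm l ⇒
           (atom (t x) ∧'
              ⋀ (map (λ p → ⟨ AtmT l ∖ p ⟩ (¬' atom (t x)))
                     (filter (λ p → is-just (l p) B.≟ true) (allFin n)))))

{-# OPTIONS --safe #-}
-- Satisfaction of every formula is ¬¬-stable (the atoms are decidable), so the
-- constructive reading of the modalities agrees with the classical one. A state
-- satisfying λ is [Atm(λ) ∖ {p}]-related exactly to the states satisfying λ with
-- its literal on p deleted, so ⟨Atm(λ) ∖ {p}⟩¬t(x) holds there iff that shorter
-- term is not an implicant of x. Every proper subterm of λ lies below one of these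
-- one-literal deletions and implicants are closed under adding literals, so λ is
-- prime iff it is an implicant and no deletion is. Finally λ is satisfiable, so
-- the [∅]-quantified right-hand side says exactly this.
module Submission where

open import Defs
open import Data.Nat using (ℕ; suc)
open import Data.Fin using (Fin)
open import Function.Bundles using (_⇔_)

open import Data.Bool using (true; false; if_then_else_)
import Data.Bool as Bool
open import Data.Bool.Properties using (¬-not; ∧-zeroʳ; ∧-identityʳ)
import Data.Fin as Fin
open import Data.Fin.Properties using (¬∀⟶∃¬)
open import Data.List using (List; []; _∷_; map; filter; allFin)
open import Data.List.Membership.Propositional.Properties using (∈-allFin; ∈-filter⁺)
open import Data.List.Relation.Unary.All as All using (All; []; _∷_)
open import Data.List.Relation.Unary.All.Properties using (map⁺; map⁻; all-filter; filter⁺)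
open import Data.Maybe using (just; nothing; is-just; fromMaybe)
open import Data.Maybe.Properties using (just-injective; ≡-dec)
open import Data.Product using (_×_; _,_; proj₁; proj₂; ∃)
open import Data.Product.Function.NonDependent.Propositional using (_×-⇔_)
open import Function.Bundles using (mk⇔; Equivalence)
import Function.Properties.Equivalence as ⇔
open import Relation.Nullary using (¬_; yes; no; does; contradiction)
open import Relation.Nullary.Decidable using (decidable-stable)
open import Relation.Nullary.Negation using (Stable; negated-stable)
open import Relation.Unary using (Decidable)
open import Relation.Binary.PropositionalEquality using (_≡_; _≢_; refl; sym; trans; cong; subst)
open import Function.Base using (_∘_)

open Equivalence using (to; from)

private
  variable
    n m : ℕ

-- `literals` recurses through an anonymous where-function; leaving the body as
-- a metavariable lets unification name that function here.
mutual
  literalsFrom : Term n → List (Fin n) → List (Fm n m)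
  literalsFrom = _

  literals≡literalsFrom : (l : Term n) → literals {n} {m} l ≡ literalsFrom l (allFin n)
  literals≡literalsFrom {n} l with allFin n
  ... | _ = refl

module _ (C : Classifier n m) where

  ⊨-stable : ∀ s φ → Stable (C , s ⊨ φ)
  ⊨-stable s (atom (var p)) = decidable-stable (s p Bool.≟ true)
  ⊨-stable s (atom (t x))   = decidable-stable (C s Fin.≟ x)
  ⊨-stable s (¬' φ)         = negated-stable
  ⊨-stable s (φ ∧' ψ) ¬¬φψ  =
    ⊨-stable s φ (λ ¬φ → ¬¬φψ (¬φ ∘ proj₁)) , ⊨-stable s ψ (λ ¬ψ → ¬¬φψ (¬ψ ∘ proj₂))
  ⊨-stable s ([ X ] φ) ¬¬□φ s' same = ⊨-stable s' φ (λ ¬φ → ¬¬□φ (λ □φ → ¬φ (□φ s' same)))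

  ⊨-⇒ : ∀ s φ ψ → (C , s ⊨ (φ ⇒ ψ)) ⇔ (C , s ⊨ φ → C , s ⊨ ψ)
  ⊨-⇒ s φ ψ = mk⇔ (λ φ⇒ψ sφ → ⊨-stable s ψ (λ ¬ψ → φ⇒ψ (sφ , ¬ψ)))
                  (λ φ→ψ (sφ , ¬ψ) → ¬ψ (φ→ψ sφ))

  ⊨-◇¬t : ∀ s X x → (C , s ⊨ (⟨ X ⟩ (¬' atom (t x)))) ⇔ (¬ (∀ s' → SameOn X s s' → C s' ≡ x))
  ⊨-◇¬t s X x = mk⇔ (λ ◇¬t □t → ◇¬t (λ s' same ¬t → ¬t (□t s' same)))
                    (λ ¬□t ¬¬□t → ¬□t (λ s' same → ⊨-stable s' (atom (t x)) (¬¬□t s' same)))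

module _ (C : Classifier n (suc m)) where

  ⊨-⋀ : ∀ s φs → (C , s ⊨ ⋀ φs) ⇔ All (C , s ⊨_) φs
  ⊨-⋀ s φs = mk⇔ (⋀⇒All φs) (All⇒⋀ φs)
    where
    ⋀⇒All : ∀ φs → C , s ⊨ ⋀ φs → All (C , s ⊨_) φs
    ⋀⇒All []           _        = []
    ⋀⇒All (φ ∷ [])     sφ       = sφ ∷ []
    ⋀⇒All (φ ∷ ψ ∷ ψs) (sφ , r) = sφ ∷ ⋀⇒All (ψ ∷ ψs) r

    All⇒⋀ : ∀ φs → All (C , s ⊨_) φs → C , s ⊨ ⋀ φs
    All⇒⋀ []           _          = λ (tt , ¬tt) → ¬tt tt
    All⇒⋀ (φ ∷ [])     (sφ ∷ [])  = sφ
    All⇒⋀ (φ ∷ ψ ∷ ψs) (sφ ∷ sψs) = sφ , All⇒⋀ (ψ ∷ ψs) sψs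

  All-map-filter-allFin : ∀ s {P : Fin n → Set} (P? : Decidable P) (f : Fin n → Fm n (suc m)) →
    All (C , s ⊨_) (map f (filter P? (allFin n))) ⇔ (∀ p → P p → C , s ⊨ f p)
  All-map-filter-allFin s P? f = mk⇔
    (λ sfs p Pp → All.lookup (map⁻ sfs) (∈-filter⁺ P? (∈-allFin p) Pp))
    (λ P⇒sf → map⁺ (All.zipWith (λ (P⇒sfp , Pp) → P⇒sfp Pp)
      (filter⁺ P? (All.tabulate {xs = allFin n} (λ {p} _ → P⇒sf p)) , all-filter P? (allFin n))))

_⊨[_]_ : State n → Fin n → Term n → Set
s ⊨[ q ] l = ∀ b → l q ≡ just b → s q ≡ b

_⊨ₜ_ : State n → Term n → Set
s ⊨ₜ l = ∀ q → s ⊨[ q ] l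

module _ (C : Classifier n (suc m)) (s : State n) (l : Term n) where

  literalsFrom-sound : ∀ qs → All (C , s ⊨_) (literalsFrom l qs) → All (s ⊨[_] l) qs
  literalsFrom-sound []       _ = []
  literalsFrom-sound (q ∷ qs) sls with l q in lq
  ... | nothing = (λ _ lq≡ → contradiction (trans (sym lq) lq≡) λ ()) ∷ literalsFrom-sound qs sls
  literalsFrom-sound (q ∷ qs) (sq ∷ sls) | just true =
    (λ _ lq≡ → trans sq (just-injective (trans (sym lq) lq≡))) ∷ literalsFrom-sound qs sls
  literalsFrom-sound (q ∷ qs) (¬sq ∷ sls) | just false =
    (λ _ lq≡ → trans (¬-not ¬sq) (just-injective (trans (sym lq) lq≡))) ∷ literalsFrom-sound qs sls

  literalsFrom-complete : ∀ qs → All (s ⊨[_] l) qs → All (C , s ⊨_) (literalsFrom l qs)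
  literalsFrom-complete []       _          = []
  literalsFrom-complete (q ∷ qs) (sq ∷ sqs) with l q
  ... | nothing    = literalsFrom-complete qs sqs
  ... | just true  = sq true refl ∷ literalsFrom-complete qs sqs
  ... | just false =
    (λ sq≡true → contradiction (trans (sym (sq false refl)) sq≡true) λ ()) ∷ literalsFrom-complete qs sqs

  ⊨-termFm : (C , s ⊨ termFm l) ⇔ (s ⊨ₜ l)
  ⊨-termFm = ⇔.trans (⊨-⋀ C s (literals l)) (mk⇔
    (λ sls q → All.lookup (literalsFrom-sound (allFin n) (subst (All _) (literals≡literalsFrom l) sls))
                          (∈-allFin q))
    (λ sl → subst (All _) (sym (literals≡literalsFrom l))
                  (literalsFrom-complete (allFin n) (All.tabulate (λ {q} _ → sl q)))))

⊨ₜ-antitone : ∀ {l' l : Term n} {s} → l' ⊆ₜ l → s ⊨ₜ l → s ⊨ₜ l'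
⊨ₜ-antitone l'⊆l sl q b l'q = sl q b (l'⊆l q b l'q)

canonicalState : Term n → State n
canonicalState l q = fromMaybe false (l q)

canonicalState-⊨ₜ : (l : Term n) → canonicalState l ⊨ₜ l
canonicalState-⊨ₜ l q b lq = cong (fromMaybe false) lq

_∖ₜ_ : Term n → Fin n → Term n
(l ∖ₜ p) q = if does (p Fin.≟ q) then nothing else l q

module _ (l : Term n) (p : Fin n) where

  ∖ₜ-self : (l ∖ₜ p) p ≡ nothing
  ∖ₜ-self with p Fin.≟ p
  ... | yes _  = refl
  ... | no p≢p = contradiction refl p≢p

  ∖ₜ-⊆ₜ : (l ∖ₜ p) ⊆ₜ l
  ∖ₜ-⊆ₜ q b lq with p Fin.≟ q
  ∖ₜ-⊆ₜ q b () | yes _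
  ∖ₜ-⊆ₜ q b lq | no _ = lq

  ∖ₜ-⊂ₜ : is-just (l p) ≡ true → (l ∖ₜ p) ⊂ₜ l
  ∖ₜ-⊂ₜ lp-just = ∖ₜ-⊆ₜ , λ same →
    contradiction (trans (cong is-just (trans (sym ∖ₜ-self) (same p))) lp-just) λ ()

  AtmT-∖ₜ : ∀ q → (AtmT {m = m} l ∖ p) (var q) ≡ AtmT {m = m} (l ∖ₜ p) (var q)
  AtmT-∖ₜ q with does (p Fin.≟ q)
  ... | true  = ∧-zeroʳ (is-just (l q))
  ... | false = ∧-identityʳ (is-just (l q))

⊂ₜ⇒⊆ₜ∖ₜ : ∀ {l' l : Term n} → l' ⊂ₜ l → ∃ λ p → is-just (l p) ≡ true × l' ⊆ₜ (l ∖ₜ p)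
⊂ₜ⇒⊆ₜ∖ₜ {n} {l'} {l} (l'⊆l , l'≢l) = dropped p l'p≢lp
  where
  differing = ¬∀⟶∃¬ n (λ q → l' q ≡ l q) (λ q → ≡-dec Bool._≟_ (l' q) (l q)) l'≢l
  p = proj₁ differing
  l'p≢lp = proj₂ differing

  dropped : ∀ p → l' p ≢ l p → ∃ λ p → is-just (l p) ≡ true × l' ⊆ₜ (l ∖ₜ p)
  dropped p l'p≢lp with l' p in l'p | l p in lp
  ... | just b  | _       = contradiction (trans (sym (l'⊆l p b l'p)) lp) l'p≢lp
  ... | nothing | nothing = contradiction refl l'p≢lp
  ... | nothing | just _  = p , cong is-just lp , l'⊆l∖p
    where
    l'⊆l∖p : l' ⊆ₜ (l ∖ₜ p)
    l'⊆l∖p q b l'q with p Fin.≟ q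
    ... | yes refl = contradiction (trans (sym l'p) l'q) λ ()
    ... | no _     = l'⊆l q b l'q

SameOn-AtmT : ∀ {l : Term n} {s s'} → s ⊨ₜ l → SameOn (AtmT {m = m} l) s s' ⇔ (s' ⊨ₜ l)
SameOn-AtmT {m = m} {l = l} {s} {s'} sl =
  mk⇔ (λ same q b lq → trans (sym (same q (cong is-just lq))) (sl q b lq)) agree⇒same
  where
  agree⇒same : s' ⊨ₜ l → SameOn (AtmT {m = m} l) s s'
  agree⇒same s'l q lq-just with l q in lq
  ... | just b = trans (sl q b lq) (sym (s'l q b lq))

SameOn-cong : ∀ {X Y : AtmSet n m} {s s'} → (∀ q → X (var q) ≡ Y (var q)) → SameOn X s s' ⇔ SameOn Y s s'
SameOn-cong X≗Y = mk⇔ (λ same q q∈Y → same q (trans (X≗Y q) q∈Y))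
                      (λ same q q∈X → same q (trans (sym (X≗Y q)) q∈X))

SameOn-AtmT∖ : ∀ {l : Term n} {p s s'} → s ⊨ₜ l → SameOn (AtmT {m = m} l ∖ p) s s' ⇔ (s' ⊨ₜ (l ∖ₜ p))
SameOn-AtmT∖ {m = m} {l = l} {p} {s} {s'} sl =
  ⇔.trans (SameOn-cong {X = AtmT {m = m} l ∖ p} {AtmT (l ∖ₜ p)} {s} {s'} (AtmT-∖ₜ l p {m = m}))
          (SameOn-AtmT {m = m} (⊨ₜ-antitone (∖ₜ-⊆ₜ l p) sl))

module _ (C : Classifier n (suc m)) (x : Fin (suc m)) where

  Implicant⇔ : ∀ l → Implicant C l x ⇔ (∀ s → s ⊨ₜ l → C s ≡ x)
  Implicant⇔ l = mk⇔ (λ imp s sl → imp s (from (⊨-termFm C s l) sl))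
                     (λ imp s sl → imp s (to (⊨-termFm C s l) sl))

  Implicant-mono : ∀ {l' l} → l' ⊆ₜ l → Implicant C l' x → Implicant C l x
  Implicant-mono {l'} {l} l'⊆l imp' =
    from (Implicant⇔ l) (λ s sl → to (Implicant⇔ l') imp' s (⊨ₜ-antitone l'⊆l sl))

  Irredundant : Term n → Set
  Irredundant l = ∀ p → is-just (l p) ≡ true → ¬ Implicant C (l ∖ₜ p) x

  PrimeImplicant⇔ : ∀ l → PrimeImplicant C l x ⇔ (Implicant C l x × Irredundant l)
  PrimeImplicant⇔ l = mk⇔
    (λ (imp , prime) → imp , λ p lp-just → prime (l ∖ₜ p) (∖ₜ-⊂ₜ l p lp-just))
    (λ (imp , ¬imp∖) → imp , λ l' l'⊂l imp' →
      let (p , lp-just , l'⊆l∖p) = ⊂ₜ⇒⊆ₜ∖ₜ l'⊂l in ¬imp∖ p lp-just (Implicant-mono l'⊆l∖p imp'))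

  ⊨-◇¬t-AtmT∖ : ∀ {l s} p → s ⊨ₜ l →
    (C , s ⊨ (⟨ AtmT l ∖ p ⟩ (¬' atom (t x)))) ⇔ (¬ Implicant C (l ∖ₜ p) x)
  ⊨-◇¬t-AtmT∖ {l} {s} p sl = ⇔.trans (⊨-◇¬t C s (AtmT l ∖ p) x) (mk⇔
    (λ ¬□t imp → ¬□t (λ s' same → to (Implicant⇔ (l ∖ₜ p)) imp s' (to related⇔ same)))
    (λ ¬imp □t → ¬imp (from (Implicant⇔ (l ∖ₜ p)) (λ s' s'l∖p → □t s' (from related⇔ s'l∖p)))))
    where
    related⇔ : ∀ {s'} → SameOn (AtmT {m = suc m} l ∖ p) s s' ⇔ (s' ⊨ₜ (l ∖ₜ p))
    related⇔ {s'} = SameOn-AtmT∖ {m = suc m} {p = p} {s' = s'} sl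

  ⊨-RHS : ∀ s l → (C , s ⊨ RHS l x) ⇔ (∀ s' → s' ⊨ₜ l → C s' ≡ x × Irredundant l)
  ⊨-RHS s l = mk⇔ sound complete
    where
    ◇¬t : Fin n → Fm n (suc m)
    ◇¬t p = ⟨ AtmT l ∖ p ⟩ (¬' atom (t x))

    essential? : Decidable (λ p → is-just (l p) ≡ true)
    essential? p = is-just (l p) Bool.≟ true

    conclusion : Fm n (suc m)
    conclusion = atom (t x) ∧' ⋀ (map ◇¬t (filter essential? (allFin n)))

    conclusion⇔ : ∀ s' → s' ⊨ₜ l → (C , s' ⊨ conclusion) ⇔ (C s' ≡ x × Irredundant l)
    conclusion⇔ s' s'l = ⇔.trans (⇔.refl ×-⇔ ⇔.trans (⊨-⋀ C s' _) (All-map-filter-allFin C s' essential? ◇¬t))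
      (⇔.refl ×-⇔ mk⇔ (λ ◇s p lp-just → to (⊨-◇¬t-AtmT∖ p s'l) (◇s p lp-just))
                      (λ irr p lp-just → from (⊨-◇¬t-AtmT∖ p s'l) (irr p lp-just)))

    sound : C , s ⊨ RHS l x → ∀ s' → s' ⊨ₜ l → C s' ≡ x × Irredundant l
    sound rhs s' s'l =
      to (conclusion⇔ s' s'l) (to (⊨-⇒ C s' (termFm l) conclusion) (rhs s' (λ _ ())) (from (⊨-termFm C s' l) s'l))

    complete : (∀ s' → s' ⊨ₜ l → C s' ≡ x × Irredundant l) → C , s ⊨ RHS l x
    complete h s' _ = from (⊨-⇒ C s' (termFm l) conclusion) λ s'⊨l →
      let s'l = to (⊨-termFm C s' l) s'⊨l in from (conclusion⇔ s' s'l) (h s' s'l)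

proposition4 : ∀ {n m} (C : Classifier n (suc m)) (s : State n) (x : Fin (suc m)) (l : Term n) →
    PrimeImplicant C l x ⇔ (C , s ⊨ RHS l x)
proposition4 C s x l =
  ⇔.trans (PrimeImplicant⇔ C x l) (⇔.trans (mk⇔ distribute collect) (⇔.sym (⊨-RHS C x s l)))
  where
  distribute : Implicant C l x × Irredundant C x l → ∀ s' → s' ⊨ₜ l → C s' ≡ x × Irredundant C x l
  distribute (imp , irr) s' s'l = to (Implicant⇔ C x l) imp s' s'l , irr

  collect : (∀ s' → s' ⊨ₜ l → C s' ≡ x × Irredundant C x l) → Implicant C l x × Irredundant C x l
  collect h = from (Implicant⇔ C x l) (λ s' s'l → proj₁ (h s' s'l))
            , proj₂ (h (canonicalState l) (canonicalState-⊨ₜ l))
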